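{- Let $n\ge 2$ and $c^1,c^2\in\mathbb{N}_+^n$ be a BUCO instance, and let $C^1:=\sum_{i=1}^n c^1_i$, $M:=C^1+1$. Construct the MSp instance on the graph $G=(V,E)$ with weights $c=(c_1,c_2)$: for each $i\in[n]$ create vertices $v_i,w_i,v_i'$ and edges $\{v_i,w_i\}$ with weight $(0,c^2_i+2)^\mathsf{T}$, $\{v_i,v_i'\}$ with weight $(0,1)^\mathsf{T}$ and $\{v_i',w_i\}$ with weight $(c^1_i,1)^\mathsf{T}$; for each $i\in[n-1]$ add the edge $\{w_i,v_{i+1}\}$ with weight $(0,1)^\mathsf{T}$; set $s:=v_1$, $t:=w_n$ and add the edge $\{s,t\}$ with weight $(M,1)^\mathsf{T}$. For $x\in\{0,1\}^n$ let $S_x\subseteq E$ consist of all edges $\{v_i,w_i\}$ and $\{v_i,v_i'\}$ for $i\in[n]$, all edges $\{w_i,v_{i+1}\}$ for $i\in[n-1]$, and the edge $\{v_i',w_i\}$ for exactly those $i$ with $x_i=0$. If $x$ is a Pareto-optimal solution of the BUCO instance, then $S_x$ is a Pareto-optimal solution of the constructed MSp instance.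
   Context: $[n]=\{1,\dots,n\}$. BUCO: feasible solutions are $x\in\{0,1\}^n$ with value vector $(-(c^1)^\mathsf{T}x,(c^2)^\mathsf{T}x)^\mathsf{T}$. MSp: feasible solutions are spanners $S\subseteq E$ (i.e. $(V,S)$ connected) with value vector $(f_1(S),f_2(S))^\mathsf{T}$, $f_1(S)=\sum_{e\in S}c_1(e)$, $f_2(S)=\max_{u,v\in V,\,u\neq v}\frac{d^S_{c_2}(u,v)}{d^E_{c_2}(u,v)}$, where $d^F_{c_2}(u,v)$ is the $c_2$-length of a shortest $u$-$v$-path in $(V,F)$. For value vectors $y\neq y'$, $y$ is dominated by $y'$ if $y'\le y$ componentwise; a feasible solution is Pareto-optimal if its value vector is not dominated by the value vector of any feasible solution. -}

module Defs where

open import Data.Nat as ℕ using (ℕ; zero; suc; _+_; _*_; _≤_; _<_; _<?_)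
open import Data.Integer as ℤ using (ℤ; +_; -_)
open import Data.Rational as ℚ using (ℚ; 0ℚ)
open import Data.Fin using (Fin; zero; suc; toℕ; fromℕ<)
open import Data.List using (List; map; allFin; cartesianProduct)
open import Data.Nat.ListAction using (sum)
open import Data.Bool using (Bool; true; false; if_then_else_; not)
open import Data.Product using (_×_; _,_; Σ; ∃; ∃-syntax)
open import Data.Sum using (_⊎_)
open import Relation.Binary.PropositionalEquality using (_≡_; _≢_)
open import Relation.Nullary using (¬_; yes; no)

dot : {n : ℕ} → (Fin n → ℕ) → (Fin n → Bool) → ℕ
dot {n} c x = sum (map (λ i → if x i then c i else 0) (allFin n))

bucoVal : {n : ℕ} → (Fin n → ℕ) → (Fin n → ℕ) → (Fin n → Bool) → ℤ × ℤ
bucoVal c¹ c² x = (- (+ dot c¹ x)) , (+ dot c² x)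

DominatedZ : ℤ × ℤ → ℤ × ℤ → Set
DominatedZ (a , b) (a' , b') = ((a , b) ≢ (a' , b')) × (a' ℤ.≤ a) × (b' ℤ.≤ b)

BUCOParetoOptimal : {n : ℕ} → (Fin n → ℕ) → (Fin n → ℕ) → (Fin n → Bool) → Set
BUCOParetoOptimal {n} c¹ c² x =
  ∀ (x' : Fin n → Bool) → ¬ DominatedZ (bucoVal c¹ c² x) (bucoVal c¹ c² x')

record Graph : Set₁ where
  field
    V     : Set
    E     : Set
    edges : List E          -- enumeration of E (each edge exactly once)
    ends  : E → V × V
    c₁    : E → ℕ
    c₂    : E → ℕ

module _ (G : Graph) where
  open Graph G

  EdgeSet : Set
  EdgeSet = E → Bool

  allEdges : EdgeSet
  allEdges _ = true

  Joins : E → V → V → Set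
  Joins e u w = (ends e ≡ (u , w)) ⊎ (ends e ≡ (w , u))

  data Walk (F : EdgeSet) : V → V → ℕ → Set where
    nil  : ∀ {u} → Walk F u u 0
    cons : ∀ {u w v ℓ} (e : E) → F e ≡ true → Joins e u w →
           Walk F w v ℓ → Walk F u v (c₂ e + ℓ)

  IsDist : EdgeSet → V → V → ℕ → Set
  IsDist F u v d = Walk F u v d × (∀ ℓ → Walk F u v ℓ → d ≤ ℓ)

  Spanner : EdgeSet → Set
  Spanner S = ∀ u v → ∃[ ℓ ] Walk S u v ℓ

  f₁ : EdgeSet → ℕ
  f₁ S = sum (map (λ e → if S e then c₁ e else 0) edges)

  -- a / b as a rational (b = 0 never occurs for distinct vertices when c₂ > 0)
  frac : ℕ → ℕ → ℚ
  frac a zero    = 0ℚ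
  frac a (suc b) = (+ a) ℚ./ suc b

  IsStretch : EdgeSet → ℚ → Set
  IsStretch S r =
    (∀ u v → u ≢ v → ∀ a b → IsDist S u v a → IsDist allEdges u v b → frac a b ℚ.≤ r)
    × (∃[ u ] ∃[ v ] (u ≢ v) × ∃[ a ] ∃[ b ]
         IsDist S u v a × IsDist allEdges u v b × (frac a b ≡ r))

  DominatedQ : ℕ × ℚ → ℕ × ℚ → Set
  DominatedQ (a , b) (a' , b') = ((a , b) ≢ (a' , b')) × (a' ℕ.≤ a) × (b' ℚ.≤ b)

  MSpParetoOptimal : EdgeSet → Set
  MSpParetoOptimal S =
    Spanner S ×
    (∀ S' → Spanner S' → ∀ r r' → IsStretch S r → IsStretch S' r' →
       ¬ DominatedQ (f₁ S , r) (f₁ S' , r'))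

data VK : Set where vK wK v'K : VK

-- edge (i , 0) = {v_i,w_i}, (i , 1) = {v_i,v_i'}, (i , 2) = {v_i',w_i},
-- (i , 3) = {w_i,v_{i+1}} if i+1 < n, and {s,t} = {v_1,w_n} if i is the last index
data EK : Set where eVW eVV' eV'W eNext : EK

firstOf : {n : ℕ} → Fin n → Fin n
firstOf zero    = zero
firstOf (suc _) = zero

allEK : List EK
allEK = eVW Data.List.∷ eVV' Data.List.∷ eV'W Data.List.∷ eNext Data.List.∷ Data.List.[]

C¹ : {n : ℕ} → (Fin n → ℕ) → ℕ
C¹ {n} c¹ = sum (map c¹ (allFin n))

redGraph : (n : ℕ) → (Fin n → ℕ) → (Fin n → ℕ) → Graph
redGraph n c¹ c² = record
  { V     = Fin n × VK
  ; E     = Fin n × EK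
  ; edges = cartesianProduct (allFin n) allEK
  ; ends  = ends'
  ; c₁    = w₁
  ; c₂    = w₂
  }
  where
  M = C¹ c¹ + 1
  ends' : Fin n × EK → (Fin n × VK) × (Fin n × VK)
  ends' (i , eVW)   = (i , vK) , (i , wK)
  ends' (i , eVV')  = (i , vK) , (i , v'K)
  ends' (i , eV'W)  = (i , v'K) , (i , wK)
  ends' (i , eNext) with suc (toℕ i) <? n
  ... | yes p = (i , wK) , (fromℕ< p , vK)
  ... | no _  = (firstOf i , vK) , (i , wK)
  w₁ : Fin n × EK → ℕ
  w₁ (i , eVW)   = 0
  w₁ (i , eVV')  = 0
  w₁ (i , eV'W)  = c¹ i
  w₁ (i , eNext) with suc (toℕ i) <? n
  ... | yes _ = 0
  ... | no _  = M
  w₂ : Fin n × EK → ℕ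
  w₂ (i , eVW)   = c² i + 2
  w₂ (i , eVV')  = 1
  w₂ (i , eV'W)  = 1
  w₂ (i , eNext) = 1

Sx : {n : ℕ} → (Fin n → Bool) → Fin n × EK → Bool
Sx x (i , eVW)   = true
Sx x (i , eVV')  = true
Sx x (i , eV'W)  = not (x i)
Sx {n} x (i , eNext) with suc (toℕ i) <? n
... | yes _ = true
... | no _  = false

-- Write L(z) for the c₂-length of the s–t path through all gadgets that takes the edge
-- {vᵢ,wᵢ} exactly when zᵢ = 1, so that L(z) + 1 = (c²)ᵀz + 3n. In S_x every vertex lies
-- within L(x) of s, and the ends of every edge of weight 1 lie within L(x) of each other,
-- so f₂(S_x) ≤ L(x). A spanner S′ dominating S_x cannot contain {s,t}, whose cost exceeds
-- C¹ ≥ f₁(S_x). Read y off S′ by yᵢ = 0 iff {v′ᵢ,wᵢ} ∈ S′: then f₁(S′) ≥ (c¹)ᵀ(1 − y), and a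
-- feasible potential shows d^{S′}(s,t) ≥ L(y), hence f₂(S′) ≥ L(y) because d^E(s,t) = 1.
-- So y is at least as good as x in both BUCO objectives; Pareto optimality of x makes the
-- objectives equal, and then S′ and S_x have the same value vector.
module Submission where

open import Defs
open import Data.Bool using (Bool; true; false; not; if_then_else_)
import Data.Bool as Bool
open import Data.Empty using (⊥; ⊥-elim)
open import Data.Fin using (Fin; zero; suc; toℕ; fromℕ; inject₁)
import Data.Fin.Properties as Finₚ
open import Data.Fin.Induction using (<-weakInduction)
open import Data.Fin.Relation.Unary.Top using (view; ‵fromℕ; ‵inject₁)
import Data.Integer as ℤ
import Data.Integer.Properties as ℤₚ
open import Data.List using ([]; _∷_; _++_; map; allFin; cartesianProduct)
open import Data.List.Properties using (map-tabulate; map-cong; map-++; map-∘)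
open import Data.List.Membership.Propositional using (_∈_; lose)
open import Data.List.Membership.Propositional.Properties using (∈-allFin; ∈-cartesianProduct⁺)
open import Data.List.Relation.Unary.Any using (Any; here; there; any?; satisfied)
open import Data.Nat
open import Data.Nat.Induction using (<-rec)
open import Data.Nat.ListAction using (sum)
open import Data.Nat.ListAction.Properties using (sum-++)
open import Data.Nat.Properties
open import Algebra.Properties.CommutativeSemigroup +-commutativeSemigroup using (interchange)
open import Data.Product using (Σ; ∃-syntax; _×_; _,_; proj₁; proj₂)
open import Data.Product.Properties using (,-injective; ≡-dec)
import Data.Rational as ℚ
import Data.Rational.Properties as ℚₚ
import Data.Rational.Unnormalised as ℚᵘ
import Data.Rational.Unnormalised.Properties as ℚᵘₚ
open import Data.Sum using (_⊎_; inj₁; inj₂)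
open import Function using (id; _∘_)
open import Relation.Binary.Definitions using (DecidableEquality)
open import Relation.Binary.PropositionalEquality
open import Relation.Nullary using (Dec; yes; no; ¬_; contradiction)
open import Relation.Nullary.Decidable using (map′; _×-dec_; _⊎-dec_; decidable-stable)
open import Relation.Unary using (Decidable)

Least : (ℕ → Set) → Set
Least P = Σ ℕ λ d → P d × (∀ k → P k → d ≤ k)

module _ {P : ℕ → Set} (P? : Decidable P) where

  least-from : ∀ j l → (∀ {k} → k < j → ¬ P k) → P (j + l) → Least P
  least-from j l below p with P? j
  ... | yes pj = j , pj , λ k pk → ≮⇒≥ λ k<j → below k<j pk
  least-from j zero below p | no ¬pj = contradiction (subst P (+-identityʳ j) p) ¬pj
  least-from j (suc l) below p | no ¬pj =
    least-from (suc j) l below′ (subst P (+-suc j l) p)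
    where
    below′ : ∀ {k} → k < suc j → ¬ P k
    below′ k<1+j with m≤n⇒m<n∨m≡n (s≤s⁻¹ k<1+j)
    ... | inj₁ k<j = below k<j
    ... | inj₂ refl = ¬pj

  least : ∀ {l} → P l → Least P
  least {l} = least-from 0 l λ ()

fraction-≤⁺ : ∀ a b c d → a * suc d ≤ c * suc b → ℤ.+ a ℚ./ suc b ℚ.≤ ℤ.+ c ℚ./ suc d
fraction-≤⁺ a b c d ad≤cb = ℚₚ.toℚᵘ-cancel-≤
  (ℚᵘₚ.≤-respˡ-≃ (ℚᵘₚ.≃-sym (ℚₚ.toℚᵘ-fromℚᵘ (ℚᵘ.mkℚᵘ (ℤ.+ a) b)))
  (ℚᵘₚ.≤-respʳ-≃ (ℚᵘₚ.≃-sym (ℚₚ.toℚᵘ-fromℚᵘ (ℚᵘ.mkℚᵘ (ℤ.+ c) d)))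
  (ℚᵘ.*≤* (subst₂ ℤ._≤_ (ℤₚ.pos-* a (suc d)) (ℤₚ.pos-* c (suc b)) (ℤ.+≤+ ad≤cb)))))

fraction-≤⁻ : ∀ a b c d → ℤ.+ a ℚ./ suc b ℚ.≤ ℤ.+ c ℚ./ suc d → a * suc d ≤ c * suc b
fraction-≤⁻ a b c d ab≤cd with
  ℚᵘₚ.≤-respˡ-≃ (ℚₚ.toℚᵘ-fromℚᵘ (ℚᵘ.mkℚᵘ (ℤ.+ a) b))
  (ℚᵘₚ.≤-respʳ-≃ (ℚₚ.toℚᵘ-fromℚᵘ (ℚᵘ.mkℚᵘ (ℤ.+ c) d)) (ℚₚ.toℚᵘ-mono-≤ ab≤cd))
... | ℚᵘ.*≤* ad≤cb =
  ℤₚ.drop‿+≤+ (subst₂ ℤ._≤_ (sym (ℤₚ.pos-* a (suc d))) (sym (ℤₚ.pos-* c (suc b))) ad≤cb)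

integer-≤⁺ : ∀ {a c} → a ≤ c → ℤ.+ a ℚ./ 1 ℚ.≤ ℤ.+ c ℚ./ 1
integer-≤⁺ {a} {c} a≤c = fraction-≤⁺ a 0 c 0 (*-monoˡ-≤ 1 a≤c)

integer-≤⁻ : ∀ {a c} → ℤ.+ a ℚ./ 1 ℚ.≤ ℤ.+ c ℚ./ 1 → a ≤ c
integer-≤⁻ {a} {c} a≤c = subst₂ _≤_ (*-identityʳ a) (*-identityʳ c) (fraction-≤⁻ a 0 c 0 a≤c)


sum-map-+ : ∀ {A : Set} (f g : A → ℕ) xs →
            sum (map (λ a → f a + g a) xs) ≡ sum (map f xs) + sum (map g xs)
sum-map-+ f g [] = refl
sum-map-+ f g (a ∷ xs) =
  trans (cong (f a + g a +_) (sum-map-+ f g xs)) (interchange (f a) (g a) _ _)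

sum-map-mono-≤ : ∀ {A : Set} {f g : A → ℕ} → (∀ a → f a ≤ g a) →
                 ∀ xs → sum (map f xs) ≤ sum (map g xs)
sum-map-mono-≤ f≤g [] = z≤n
sum-map-mono-≤ f≤g (a ∷ xs) = +-mono-≤ (f≤g a) (sum-map-mono-≤ f≤g xs)

sum-map-∈-≤ : ∀ {A : Set} (f : A → ℕ) {a xs} → a ∈ xs → f a ≤ sum (map f xs)
sum-map-∈-≤ f (here refl) = m≤m+n _ _
sum-map-∈-≤ f {xs = b ∷ _} (there a∈xs) = ≤-trans (sum-map-∈-≤ f a∈xs) (m≤n+m _ (f b))

sum-cartesianProduct : ∀ {A B : Set} (f : A × B → ℕ) xs ys →
  sum (map f (cartesianProduct xs ys)) ≡ sum (map (λ a → sum (map (λ b → f (a , b)) ys)) xs)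
sum-cartesianProduct f [] ys = refl
sum-cartesianProduct f (a ∷ xs) ys = begin
  sum (map f (map (a ,_) ys ++ cartesianProduct xs ys))
    ≡⟨ cong sum (map-++ f (map (a ,_) ys) _) ⟩
  sum (map f (map (a ,_) ys) ++ map f (cartesianProduct xs ys))
    ≡⟨ sum-++ (map f (map (a ,_) ys)) _ ⟩
  sum (map f (map (a ,_) ys)) + sum (map f (cartesianProduct xs ys))
    ≡⟨ cong₂ _+_ (cong sum (sym (map-∘ ys))) (sum-cartesianProduct f xs ys) ⟩
  sum (map (λ b → f (a , b)) ys) + sum (map (λ a → sum (map (λ b → f (a , b)) ys)) xs) ∎
  where open ≡-Reasoning

∑ : ∀ {k} → (Fin k → ℕ) → ℕ
∑ {k} f = sum (map f (allFin k))

∑-suc : ∀ {k} (f : Fin (suc k) → ℕ) → ∑ f ≡ f zero + ∑ (f ∘ suc)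
∑-suc f = cong (λ fs → f zero + sum fs) (trans (map-tabulate suc f) (sym (map-tabulate id (f ∘ suc))))

∑-cong : ∀ {k} {f g : Fin k → ℕ} → (∀ i → f i ≡ g i) → ∑ f ≡ ∑ g
∑-cong {k} f≗g = cong sum (map-cong f≗g (allFin k))

∑-distrib-+ : ∀ {k} (f g : Fin k → ℕ) → ∑ (λ i → f i + g i) ≡ ∑ f + ∑ g
∑-distrib-+ {k} f g = sum-map-+ f g (allFin k)

∑-mono-≤ : ∀ {k} {f g : Fin k → ℕ} → (∀ i → f i ≤ g i) → ∑ f ≤ ∑ g
∑-mono-≤ {k} f≤g = sum-map-mono-≤ f≤g (allFin k)

∑< : ∀ {k} → (Fin k → ℕ) → Fin k → ℕ
∑< f zero = 0
∑< f (suc i) = f zero + ∑< (f ∘ suc) i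

∑<-inject₁ : ∀ {k} (f : Fin (suc k) → ℕ) (i : Fin k) →
             ∑< f (suc i) ≡ ∑< f (inject₁ i) + f (inject₁ i)
∑<-inject₁ f zero = +-comm (f zero) 0
∑<-inject₁ f (suc i) =
  trans (cong (f zero +_) (∑<-inject₁ (f ∘ suc) i)) (sym (+-assoc (f zero) _ _))

∑<-fromℕ : ∀ {m} (f : Fin (suc m) → ℕ) → ∑< f (fromℕ m) + f (fromℕ m) ≡ ∑ f
∑<-fromℕ {zero} f = +-comm 0 (f zero)
∑<-fromℕ {suc m} f =
  trans (+-assoc (f zero) _ _) (trans (cong (f zero +_) (∑<-fromℕ (f ∘ suc))) (sym (∑-suc f)))

∑<-+-≤ : ∀ {k} (f : Fin k → ℕ) i → ∑< f i + f i ≤ ∑ f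
∑<-+-≤ f zero = ≤-trans (m≤m+n (f zero) _) (≤-reflexive (sym (∑-suc f)))
∑<-+-≤ f (suc i) = begin
  f zero + ∑< (f ∘ suc) i + f (suc i)   ≡⟨ +-assoc (f zero) _ _ ⟩
  f zero + (∑< (f ∘ suc) i + f (suc i)) ≤⟨ +-monoʳ-≤ (f zero) (∑<-+-≤ (f ∘ suc) i) ⟩
  f zero + ∑ (f ∘ suc)                  ≡⟨ ∑-suc f ⟨
  ∑ f                                   ∎
  where open ≤-Reasoning

∑-lookup-≤ : ∀ {k} (f : Fin k → ℕ) i → f i ≤ ∑ f
∑-lookup-≤ f i = sum-map-∈-≤ f (∈-allFin i)

∑-pair-≤ : ∀ {k} (f : Fin k → ℕ) {i j} → i ≢ j → f i + f j ≤ ∑ f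
∑-pair-≤ f {zero} {zero} i≢j = contradiction refl i≢j
∑-pair-≤ f {zero} {suc j} _ =
  subst (f zero + f (suc j) ≤_) (sym (∑-suc f)) (+-monoʳ-≤ (f zero) (∑-lookup-≤ (f ∘ suc) j))
∑-pair-≤ f {suc i} {zero} _ =
  subst₂ _≤_ (+-comm (f zero) _) (sym (∑-suc f)) (+-monoʳ-≤ (f zero) (∑-lookup-≤ (f ∘ suc) i))
∑-pair-≤ f {suc i} {suc j} i≢j = begin
  f (suc i) + f (suc j)  ≤⟨ ∑-pair-≤ (f ∘ suc) (i≢j ∘ cong suc) ⟩
  ∑ (f ∘ suc)            ≤⟨ m≤n+m _ (f zero) ⟩
  f zero + ∑ (f ∘ suc)   ≡⟨ ∑-suc f ⟨
  ∑ f                    ∎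
  where open ≤-Reasoning

module Walks (G : Graph) where
  open Graph G

  _++ʷ_ : ∀ {F u w v ℓ ℓ′} → Walk G F u w ℓ → Walk G F w v ℓ′ → Walk G F u v (ℓ + ℓ′)
  nil ++ʷ q = q
  _++ʷ_ {ℓ′ = ℓ′} (cons {ℓ = ℓ} e e∈F j p) q =
    subst (Walk G _ _ _) (sym (+-assoc (c₂ e) ℓ ℓ′)) (cons e e∈F j (p ++ʷ q))

  Joins-sym : ∀ {e u w} → Joins G e u w → Joins G e w u
  Joins-sym (inj₁ eq) = inj₂ eq
  Joins-sym (inj₂ eq) = inj₁ eq

  edge-walk : ∀ {F} e {u w} → F e ≡ true → Joins G e u w → Walk G F u w (c₂ e)
  edge-walk e e∈F j = subst (Walk G _ _ _) (+-identityʳ (c₂ e)) (cons e e∈F j nil)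

  reverse : ∀ {F u v ℓ} → Walk G F u v ℓ → Walk G F v u ℓ
  reverse nil = nil
  reverse (cons {ℓ = ℓ} e e∈F j p) =
    subst (Walk G _ _ _) (+-comm ℓ (c₂ e)) (reverse p ++ʷ edge-walk e e∈F (Joins-sym j))

  Reach : EdgeSet G → V → V → ℕ → Set
  Reach F u v R = ∃[ ℓ ] ℓ ≤ R × Walk G F u v ℓ

  FeasiblePotential : EdgeSet G → (V → ℕ) → Set
  FeasiblePotential F φ = ∀ e {a b} → F e ≡ true → ends e ≡ (a , b) →
                          φ b ≤ φ a + c₂ e × φ a ≤ φ b + c₂ e

  potential-≤ : ∀ {F φ} → FeasiblePotential F φ → ∀ {u v ℓ} → Walk G F u v ℓ → φ v ≤ φ u + ℓ
  potential-≤ {φ = φ} feasible {u} nil = m≤m+n (φ u) 0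
  potential-≤ {φ = φ} feasible {u} {v} (cons {w = w} {ℓ = ℓ} e e∈F j p) = begin
    φ v              ≤⟨ potential-≤ feasible p ⟩
    φ w + ℓ          ≤⟨ +-monoˡ-≤ ℓ (step j) ⟩
    φ u + c₂ e + ℓ   ≡⟨ +-assoc (φ u) (c₂ e) ℓ ⟩
    φ u + (c₂ e + ℓ) ∎
    where
    open ≤-Reasoning
    step : Joins G e u w → φ w ≤ φ u + c₂ e
    step (inj₁ uw) = proj₁ (feasible e e∈F uw)
    step (inj₂ wu) = proj₂ (feasible e e∈F wu)

  module PositiveWeights (c₂-pos : ∀ e → 1 ≤ c₂ e) where

    walk-length-0 : ∀ {F u v ℓ} → Walk G F u v ℓ → ℓ ≡ 0 → u ≡ v
    walk-length-0 nil _ = refl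
    walk-length-0 (cons e _ _ _) eq = ⊥-elim (<⇒≢ (c₂-pos e) (sym (m+n≡0⇒m≡0 (c₂ e) eq)))

    walk-length-pos : ∀ {F u v ℓ} → Walk G F u v ℓ → u ≢ v → 1 ≤ ℓ
    walk-length-pos nil u≢u = contradiction refl u≢u
    walk-length-pos (cons e _ _ _) _ = ≤-trans (c₂-pos e) (m≤m+n _ _)

    unit-walk-edge : ∀ {F u v ℓ} → Walk G F u v ℓ → ℓ ≡ 1 →
                     ∃[ e ] F e ≡ true × Joins G e u v × c₂ e ≡ 1
    unit-walk-edge (cons {u = u} e e∈F j p) eq with c₂ e in c≡ | c₂-pos e
    ... | suc c | s≤s _ =
      e , e∈F , subst (Joins G e u) (walk-length-0 p (m+n≡0⇒n≡0 c (suc-injective eq))) j ,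
      trans c≡ (cong suc (m+n≡0⇒m≡0 c (suc-injective eq)))

    unit-edge-dist : ∀ {e u v} → c₂ e ≡ 1 → Joins G e u v → u ≢ v → IsDist G (allEdges G) u v 1
    unit-edge-dist {e} c≡1 j u≢v =
      subst (Walk G _ _ _) c≡1 (edge-walk e refl j) , λ ℓ p → walk-length-pos p u≢v

    stretch-≥ : ∀ {F r u v e a} → IsStretch G F r → u ≢ v → c₂ e ≡ 1 → Joins G e u v →
                IsDist G F u v a → ℤ.+ a ℚ./ 1 ℚ.≤ r
    stretch-≥ (bounded , _) u≢v c≡1 j dist =
      bounded _ _ u≢v _ 1 dist (unit-edge-dist c≡1 j u≢v)

    stretch-≤ : ∀ {F z R r} → (∀ u → Reach F z u R) →
                (∀ e → c₂ e ≡ 1 → Reach F (proj₁ (ends e)) (proj₂ (ends e)) R) →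
                IsStretch G F r → r ℚ.≤ ℤ.+ R ℚ./ 1
    stretch-≤ {F} {R = R} center unit (_ , u , v , u≢v , a , b , (_ , a-min) , (p , _) , refl) =
      bound b p
      where
      via-center : a ≤ R + R
      via-center with center u | center v
      ... | _ , ℓ≤R , q | _ , ℓ′≤R , q′ = ≤-trans (a-min _ (reverse q ++ʷ q′)) (+-mono-≤ ℓ≤R ℓ′≤R)
      along : ∀ {e} → Joins G e u v → Reach F (proj₁ (ends e)) (proj₂ (ends e)) R → a ≤ R
      along (inj₁ refl) (ℓ , ℓ≤R , q) = ≤-trans (a-min ℓ q) ℓ≤R
      along (inj₂ refl) (ℓ , ℓ≤R , q) = ≤-trans (a-min ℓ (reverse q)) ℓ≤R
      bound : ∀ b → Walk G (allEdges G) u v b → frac G a b ℚ.≤ ℤ.+ R ℚ./ 1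
      bound zero p = contradiction (walk-length-pos p u≢v) λ ()
      bound (suc zero) p with unit-walk-edge p refl
      ... | e , _ , j , c≡1 = integer-≤⁺ (along j (unit e c≡1))
      bound (suc (suc b)) _ = fraction-≤⁺ a (suc b) R 0 (begin
        a * 1             ≡⟨ *-identityʳ a ⟩
        a                 ≤⟨ via-center ⟩
        R + R             ≡⟨ cong (R +_) (+-identityʳ R) ⟨
        2 * R             ≡⟨ *-comm 2 R ⟩
        R * 2             ≤⟨ *-monoʳ-≤ R (s≤s (s≤s z≤n)) ⟩
        R * suc (suc b)   ∎)
        where open ≤-Reasoning

    module Distances (_≟_ : DecidableEquality V) (edges-complete : ∀ e → e ∈ edges)
                     (F : EdgeSet G) (v : V) where

      neighbour? : ∀ {P : V → Set} → (∀ w → Dec (P w)) →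
                   ∀ e u → Dec (∃[ w ] Joins G e u w × P w)
      neighbour? {P} P? e u = map′ to from ((a ≟ u ×-dec P? b) ⊎-dec (b ≟ u ×-dec P? a))
        where
        a b : V
        a = proj₁ (ends e)
        b = proj₂ (ends e)
        to : (a ≡ u × P b) ⊎ (b ≡ u × P a) → ∃[ w ] Joins G e u w × P w
        to (inj₁ (refl , pb)) = b , inj₁ refl , pb
        to (inj₂ (refl , pa)) = a , inj₂ refl , pa
        from : ∃[ w ] Joins G e u w × P w → (a ≡ u × P b) ⊎ (b ≡ u × P a)
        from (w , inj₁ uw , pw) with ,-injective uw
        ... | a≡u , b≡w = inj₁ (a≡u , subst P (sym b≡w) pw)
        from (w , inj₂ wu , pw) with ,-injective wu
        ... | a≡w , b≡u = inj₂ (b≡u , subst P (sym a≡w) pw)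

      FirstStep : ℕ → V → E → Set
      FirstStep ℓ u e =
        F e ≡ true × c₂ e ≤ ℓ × ∃[ w ] Joins G e u w × Walk G F w v (ℓ ∸ c₂ e)

      firstStep-walk : ∀ {ℓ u e} → FirstStep ℓ u e → Walk G F u v ℓ
      firstStep-walk {e = e} (e∈F , c≤ℓ , w , j , p) =
        subst (Walk G F _ v) (m+[n∸m]≡n c≤ℓ) (cons e e∈F j p)

      walk-firstStep : ∀ {u ℓ} → Walk G F u v ℓ → 0 < ℓ → Any (FirstStep ℓ u) edges
      walk-firstStep (cons {w = w} {ℓ = ℓ} e e∈F j p) _ =
        lose (edges-complete e)
          (e∈F , m≤m+n (c₂ e) ℓ , w , j , subst (Walk G F w v) (sym (m+n∸m≡n (c₂ e) ℓ)) p)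

      walk? : ∀ ℓ u → Dec (Walk G F u v ℓ)
      walk? = <-rec (λ ℓ → ∀ u → Dec (Walk G F u v ℓ)) step
        where
        step : ∀ ℓ → (∀ {k} → k < ℓ → ∀ u → Dec (Walk G F u v k)) →
               ∀ u → Dec (Walk G F u v ℓ)
        step zero _ u = map′ (λ { refl → nil }) (λ p → walk-length-0 p refl) (u ≟ v)
        step (suc k) shorter u =
          map′ (firstStep-walk ∘ proj₂ ∘ satisfied) (λ p → walk-firstStep p z<s)
               (any? firstStep? edges)
          where
          firstStep? : ∀ e → Dec (FirstStep (suc k) u e)
          firstStep? e = (F e Bool.≟ true) ×-dec (c₂ e ≤? suc k) ×-dec
                         neighbour? (shorter (s≤s (∸-monoʳ-≤ (suc k) (c₂-pos e)))) e u

      distance : ∀ {u ℓ} → Walk G F u v ℓ → ∃[ d ] IsDist G F u v d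
      distance {u} = least (λ ℓ → walk? ℓ u)

dot-not : ∀ {m} (c : Fin m → ℕ) z → dot c z + dot c (not ∘ z) ≡ C¹ c
dot-not c z = trans (sym (∑-distrib-+ (λ i → if z i then c i else 0) (λ i → if not (z i) then c i else 0)))
                     (∑-cong split)
  where
  split : ∀ i → (if z i then c i else 0) + (if not (z i) then c i else 0) ≡ c i
  split i with z i
  ... | true = +-identityʳ (c i)
  ... | false = refl

pareto-optimal-≡ : ∀ {m} {c¹ c² : Fin m → ℕ} {x} → BUCOParetoOptimal c¹ c² x →
                   ∀ y → dot c¹ x ≤ dot c¹ y → dot c² y ≤ dot c² x →
                   dot c¹ x ≡ dot c¹ y × dot c² x ≡ dot c² y
pareto-optimal-≡ {c¹ = c¹} {c²} {x} pareto y c¹x≤c¹y c²y≤c²x =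
  decidable-stable (dot c¹ x ≟ dot c¹ y)
    (λ c¹≢ → not-dominated (c¹≢ ∘ ℤₚ.+-injective ∘ ℤₚ.neg-injective ∘ cong proj₁)) ,
  decidable-stable (dot c² x ≟ dot c² y)
    (λ c²≢ → not-dominated (c²≢ ∘ ℤₚ.+-injective ∘ cong proj₂))
  where
  not-dominated : bucoVal c¹ c² x ≢ bucoVal c¹ c² y → ⊥
  not-dominated ≢ = pareto y (≢ , ℤₚ.neg-mono-≤ (ℤ.+≤+ c¹x≤c¹y) , ℤ.+≤+ c²y≤c²x)

Sx-next : ∀ {n} x (i : Fin n) → suc (toℕ i) < n → Sx x (i , eNext) ≡ true
Sx-next {n} x i i+1<n with suc (toℕ i) <? n
... | yes _ = refl
... | no i+1≮n = contradiction i+1<n i+1≮n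

module Reduction (k : ℕ) (c¹ c² : Fin (suc (suc k)) → ℕ) where

  n : ℕ
  n = suc (suc k)

  G : Graph
  G = redGraph n c¹ c²

  open Graph G
  open Walks G

  c₂-pos : ∀ e → 1 ≤ c₂ e
  c₂-pos (i , eVW) = ≤-trans (s≤s z≤n) (m≤n+m 2 (c² i))
  c₂-pos (i , eVV') = ≤-refl
  c₂-pos (i , eV'W) = ≤-refl
  c₂-pos (i , eNext) = ≤-refl

  open PositiveWeights c₂-pos

  _≟ᵏ_ : DecidableEquality VK
  vK ≟ᵏ vK = yes refl
  vK ≟ᵏ wK = no λ ()
  vK ≟ᵏ v'K = no λ ()
  wK ≟ᵏ vK = no λ ()
  wK ≟ᵏ wK = yes refl
  wK ≟ᵏ v'K = no λ ()
  v'K ≟ᵏ vK = no λ ()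
  v'K ≟ᵏ wK = no λ ()
  v'K ≟ᵏ v'K = yes refl

  ∈-allEK : ∀ κ → κ ∈ allEK
  ∈-allEK eVW = here refl
  ∈-allEK eVV' = there (here refl)
  ∈-allEK eV'W = there (there (here refl))
  ∈-allEK eNext = there (there (there (here refl)))

  edges-complete : ∀ e → e ∈ edges
  edges-complete (i , κ) = ∈-cartesianProduct⁺ (∈-allFin i) (∈-allEK κ)

  _≟ᵛ_ : DecidableEquality V
  _≟ᵛ_ = ≡-dec Finₚ._≟_ _≟ᵏ_

  last : Fin n
  last = fromℕ (suc k)

  s t : V
  s = zero , vK
  t = last , wK

  s≢t : s ≢ t
  s≢t ()

  ends-inner : ∀ j → ends (inject₁ j , eNext) ≡ ((inject₁ j , wK) , (suc j , vK))
  ends-inner j with suc (toℕ (inject₁ j)) <? n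
  ... | yes j+1<n = cong (λ i → (inject₁ j , wK) , (i , vK)) (Finₚ.toℕ-injective
                      (trans (Finₚ.toℕ-fromℕ< j+1<n) (cong suc (Finₚ.toℕ-inject₁ j))))
  ... | no j+1≮n = contradiction (s≤s (Finₚ.inject₁ℕ< j)) j+1≮n

  Sx-inner : ∀ (x : Fin n → Bool) j → Sx x (inject₁ j , eNext) ≡ true
  Sx-inner x j = Sx-next x (inject₁ j) (s≤s (Finₚ.inject₁ℕ< j))

  last+1≮n : ¬ (suc (toℕ last) < n)
  last+1≮n last+1<n = <-irrefl (Finₚ.toℕ-fromℕ (suc k)) (s≤s⁻¹ last+1<n)

  ends-last : ends (last , eNext) ≡ (s , t)
  ends-last with suc (toℕ last) <? n
  ... | yes last+1<n = contradiction last+1<n last+1≮n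
  ... | no _ = refl

  c₁-last : c₁ (last , eNext) ≡ C¹ c¹ + 1
  c₁-last with suc (toℕ last) <? n
  ... | yes last+1<n = contradiction last+1<n last+1≮n
  ... | no _ = refl

  edgeCost : EdgeSet G → E → ℕ
  edgeCost S e = if S e then c₁ e else 0

  gadgetCost : EdgeSet G → Fin n → ℕ
  gadgetCost S i = sum (map (λ κ → edgeCost S (i , κ)) allEK)

  edgeCost-≤ : ∀ S i κ → edgeCost S (i , κ) ≤ gadgetCost S i
  edgeCost-≤ S i κ = sum-map-∈-≤ (λ κ → edgeCost S (i , κ)) (∈-allEK κ)

  f₁-∑ : ∀ S → f₁ G S ≡ ∑ (gadgetCost S)
  f₁-∑ S = sum-cartesianProduct (edgeCost S) (allFin n) allEK

  decode : EdgeSet G → Fin n → Bool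
  decode S i = not (S (i , eV'W))

  Sx-cost : ∀ x → dot c¹ x + f₁ G (Sx x) ≡ C¹ c¹
  Sx-cost x = trans (cong (dot c¹ x +_) (trans (f₁-∑ (Sx x)) (∑-cong gadget))) (dot-not c¹ x)
    where
    gadget : ∀ i → gadgetCost (Sx x) i ≡ (if not (x i) then c¹ i else 0)
    -- an inner edge {wᵢ,vᵢ₊₁} costs nothing, and {s,t} is not in Sx x
    gadget i with suc (toℕ i) <? n
    ... | yes _ = +-identityʳ _
    ... | no _ = +-identityʳ _

  Sx-cost-≤ : ∀ x → f₁ G (Sx x) ≤ C¹ c¹
  Sx-cost-≤ x = ≤-trans (m≤n+m _ (dot c¹ x)) (≤-reflexive (Sx-cost x))

  decode-cost : ∀ S → C¹ c¹ ≤ dot c¹ (decode S) + f₁ G S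
  decode-cost S = begin
    C¹ c¹                                        ≡⟨ dot-not c¹ chosen ⟨
    dot c¹ chosen + dot c¹ (decode S)            ≡⟨ +-comm (dot c¹ chosen) _ ⟩
    dot c¹ (decode S) + dot c¹ chosen            ≤⟨ +-monoʳ-≤ (dot c¹ (decode S)) chosen-≤ ⟩
    dot c¹ (decode S) + f₁ G S                   ∎
    where
    open ≤-Reasoning
    chosen : Fin n → Bool
    chosen i = S (i , eV'W)
    chosen-≤ : dot c¹ chosen ≤ f₁ G S
    chosen-≤ = ≤-trans (∑-mono-≤ {f = λ i → edgeCost S (i , eV'W)} (λ i → edgeCost-≤ S i eV'W))
                       (≤-reflexive (sym (f₁-∑ S)))

  cost-≤⇒dot-≤ : ∀ x S → f₁ G S ≤ f₁ G (Sx x) → dot c¹ x ≤ dot c¹ (decode S)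
  cost-≤⇒dot-≤ x S S≤Sx = +-cancelʳ-≤ (f₁ G (Sx x)) _ _ (begin
    dot c¹ x + f₁ G (Sx x)            ≡⟨ Sx-cost x ⟩
    C¹ c¹                             ≤⟨ decode-cost S ⟩
    dot c¹ (decode S) + f₁ G S        ≤⟨ +-monoʳ-≤ (dot c¹ (decode S)) S≤Sx ⟩
    dot c¹ (decode S) + f₁ G (Sx x)   ∎)
    where open ≤-Reasoning

  dot-≡⇒cost-≥ : ∀ x S → dot c¹ x ≡ dot c¹ (decode S) → f₁ G (Sx x) ≤ f₁ G S
  dot-≡⇒cost-≥ x S x≡S = +-cancelˡ-≤ (dot c¹ x) _ _ (begin
    dot c¹ x + f₁ G (Sx x)            ≡⟨ Sx-cost x ⟩
    C¹ c¹                             ≤⟨ decode-cost S ⟩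
    dot c¹ (decode S) + f₁ G S        ≡⟨ cong (_+ f₁ G S) x≡S ⟨
    dot c¹ x + f₁ G S                 ∎)
    where open ≤-Reasoning

  st-cost : ∀ S → S (last , eNext) ≡ true → C¹ c¹ < f₁ G S
  st-cost S st∈S = begin
    suc (C¹ c¹)             ≡⟨ +-comm 1 (C¹ c¹) ⟩
    C¹ c¹ + 1               ≡⟨ c₁-last ⟨
    c₁ (last , eNext)       ≡⟨ cong (λ b → if b then c₁ (last , eNext) else 0) st∈S ⟨
    edgeCost S (last , eNext)
      ≤⟨ edgeCost-≤ S last eNext ⟩
    gadgetCost S last       ≤⟨ ∑-lookup-≤ (gadgetCost S) last ⟩
    ∑ (gadgetCost S)        ≡⟨ f₁-∑ S ⟨
    f₁ G S                  ∎
    where open ≤-Reasoning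

  gadgetLength : (Fin n → Bool) → Fin n → ℕ
  gadgetLength z i = if z i then c² i + 2 else 2

  gadgetStart : (Fin n → Bool) → Fin n → ℕ
  gadgetStart z = ∑< (λ i → gadgetLength z i + 1)

  pathLength : (Fin n → Bool) → ℕ
  pathLength z = gadgetStart z last + gadgetLength z last

  2≤gadgetLength : ∀ z i → 2 ≤ gadgetLength z i
  2≤gadgetLength z i with z i
  ... | true = m≤n+m 2 (c² i)
  ... | false = ≤-refl

  gadgetLength-≤ : ∀ z i → gadgetLength z i ≤ c² i + 2
  gadgetLength-≤ z i with z i
  ... | true = ≤-refl
  ... | false = m≤n+m 2 (c² i)

  pathLength+1 : ∀ z → pathLength z + 1 ≡ ∑ (λ i → gadgetLength z i + 1)
  pathLength+1 z = trans (+-assoc (gadgetStart z last) _ 1) (∑<-fromℕ (λ i → gadgetLength z i + 1))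

  pathLength-dot : ∀ z → pathLength z + 1 ≡ dot c² z + ∑ {n} (λ _ → 3)
  pathLength-dot z = trans (pathLength+1 z)
    (trans (∑-cong split) (∑-distrib-+ (λ i → if z i then c² i else 0) (λ _ → 3)))
    where
    split : ∀ i → gadgetLength z i + 1 ≡ (if z i then c² i else 0) + 3
    split i with z i
    ... | true = +-assoc (c² i) 2 1
    ... | false = refl

  pathLength-≤⇒dot-≤ : ∀ y z → pathLength y ≤ pathLength z → dot c² y ≤ dot c² z
  pathLength-≤⇒dot-≤ y z y≤z =
    +-cancelʳ-≤ (∑ {n} (λ _ → 3)) _ _
      (subst₂ _≤_ (pathLength-dot y) (pathLength-dot z) (+-monoˡ-≤ 1 y≤z))

  dot-≡⇒pathLength-≡ : ∀ y z → dot c² y ≡ dot c² z → pathLength y ≡ pathLength z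
  dot-≡⇒pathLength-≡ y z y≡z =
    +-cancelʳ-≡ 1 _ _
      (trans (pathLength-dot y) (trans (cong (_+ ∑ {n} (λ _ → 3)) y≡z) (sym (pathLength-dot z))))

  gadget-≤-pathLength : ∀ z i → gadgetStart z i + gadgetLength z i ≤ pathLength z
  gadget-≤-pathLength z i = +-cancelʳ-≤ 1 _ _ (begin
    gadgetStart z i + gadgetLength z i + 1    ≡⟨ +-assoc (gadgetStart z i) _ 1 ⟩
    gadgetStart z i + (gadgetLength z i + 1)  ≤⟨ ∑<-+-≤ (λ i → gadgetLength z i + 1) i ⟩
    ∑ (λ i → gadgetLength z i + 1)            ≡⟨ pathLength+1 z ⟨
    pathLength z + 1                          ∎)
    where open ≤-Reasoning

  -- The only place where n ≥ 2 is used: the path also passes through a second gadget.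
  1+gadgetLength-≤-pathLength : ∀ z i → 1 + gadgetLength z i ≤ pathLength z
  1+gadgetLength-≤-pathLength z i = +-cancelʳ-≤ 1 _ _ (begin
    1 + gadgetLength z i + 1                      ≡⟨ cong (_+ 1) (+-comm 1 (gadgetLength z i)) ⟩
    gadgetLength z i + 1 + 1
      ≤⟨ +-monoʳ-≤ (gadgetLength z i + 1) (m≤n+m 1 (gadgetLength z (other i))) ⟩
    gadgetLength z i + 1 + (gadgetLength z (other i) + 1)
      ≤⟨ ∑-pair-≤ (λ i → gadgetLength z i + 1) (other-≢ i) ⟩
    ∑ (λ i → gadgetLength z i + 1)                ≡⟨ pathLength+1 z ⟨
    pathLength z + 1                              ∎)
    where
    open ≤-Reasoning
    other : Fin n → Fin n
    other zero = suc zero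
    other (suc _) = zero
    other-≢ : ∀ i → i ≢ other i
    other-≢ zero ()
    other-≢ (suc _) ()

  1≤pathLength : ∀ z → 1 ≤ pathLength z
  1≤pathLength z = ≤-trans (m≤m+n 1 _) (1+gadgetLength-≤-pathLength z zero)

  gadget-walk : ∀ x i → Walk G (Sx x) (i , vK) (i , wK) (gadgetLength x i)
  gadget-walk x i with x i in xᵢ
  ... | true = edge-walk (i , eVW) refl (inj₁ refl)
  ... | false =
    edge-walk (i , eVV') refl (inj₁ refl) ++ʷ edge-walk (i , eV'W) (cong not xᵢ) (inj₁ refl)

  walk-to-gadget : ∀ x i → Walk G (Sx x) s (i , vK) (gadgetStart x i)
  walk-to-gadget x = <-weakInduction (λ i → Walk G (Sx x) s (i , vK) (gadgetStart x i)) nil next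
    where
    next : ∀ j → Walk G (Sx x) s (inject₁ j , vK) (gadgetStart x (inject₁ j)) →
           Walk G (Sx x) s (suc j , vK) (gadgetStart x (suc j))
    next j p = subst (Walk G (Sx x) s (suc j , vK))
      (trans (+-assoc (gadgetStart x (inject₁ j)) _ 1) (sym (∑<-inject₁ (λ i → gadgetLength x i + 1) j)))
      ((p ++ʷ gadget-walk x (inject₁ j)) ++ʷ
       edge-walk (inject₁ j , eNext) (Sx-inner x j) (inj₁ (ends-inner j)))

  reach-from-s : ∀ x u → Reach (Sx x) s u (pathLength x)
  reach-from-s x (i , vK) =
    _ , ≤-trans (m≤m+n _ _) (gadget-≤-pathLength x i) , walk-to-gadget x i
  reach-from-s x (i , wK) =
    _ , gadget-≤-pathLength x i , walk-to-gadget x i ++ʷ gadget-walk x i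
  reach-from-s x (i , v'K) =
    _ , ≤-trans (+-monoʳ-≤ _ (≤-trans (s≤s z≤n) (2≤gadgetLength x i))) (gadget-≤-pathLength x i) ,
    walk-to-gadget x i ++ʷ edge-walk (i , eVV') refl (inj₁ refl)

  Sx-spanner : ∀ x → Spanner G (Sx x)
  Sx-spanner x u v with reach-from-s x u | reach-from-s x v
  ... | _ , _ , p | _ , _ , q = _ , reverse p ++ʷ q

  unit-edge-reach : ∀ x e → c₂ e ≡ 1 →
                    Reach (Sx x) (proj₁ (ends e)) (proj₂ (ends e)) (pathLength x)
  unit-edge-reach x (i , eVW) c≡1 = contradiction (sym c≡1) (<⇒≢ (m≤n+m 2 (c² i)))
  unit-edge-reach x (i , eVV') _ = 1 , 1≤pathLength x , edge-walk (i , eVV') refl (inj₁ refl)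
  unit-edge-reach x (i , eV'W) _ =
    _ , 1+gadgetLength-≤-pathLength x i , edge-walk (i , eVV') refl (inj₂ refl) ++ʷ gadget-walk x i
  unit-edge-reach x (i , eNext) _ with view i
  ... | ‵inject₁ j = 1 , 1≤pathLength x , edge-walk (inject₁ j , eNext) (Sx-inner x j) (inj₁ refl)
  ... | ‵fromℕ =
    subst (λ st → Reach (Sx x) (proj₁ st) (proj₂ st) (pathLength x)) (sym ends-last) (reach-from-s x t)

  Sx-stretch-≤ : ∀ x {r} → IsStretch G (Sx x) r → r ℚ.≤ ℤ.+ pathLength x ℚ./ 1
  Sx-stretch-≤ x = stretch-≤ (reach-from-s x) (unit-edge-reach x)

  -- Feasible on {v′ᵢ,wᵢ} since that edge lies in S only when decode S i = false, i.e. gadget length 2.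
  decode-potential : EdgeSet G → V → ℕ
  decode-potential S (i , vK) = gadgetStart (decode S) i
  decode-potential S (i , wK) = gadgetStart (decode S) i + gadgetLength (decode S) i
  decode-potential S (i , v'K) = gadgetStart (decode S) i + 1

  decode-potential-feasible : ∀ S → S (last , eNext) ≡ false →
                              FeasiblePotential S (decode-potential S)
  decode-potential-feasible S _ (i , eVW) _ refl =
    +-monoʳ-≤ (gadgetStart (decode S) i) (gadgetLength-≤ (decode S) i) ,
    ≤-trans (m≤m+n _ (gadgetLength (decode S) i)) (m≤m+n _ _)
  decode-potential-feasible S _ (i , eVV') _ refl =
    ≤-refl , ≤-trans (m≤m+n _ 1) (m≤m+n _ 1)
  decode-potential-feasible S _ (i , eV'W) v′w∈S refl rewrite v′w∈S =
    ≤-reflexive (sym (+-assoc (gadgetStart (decode S) i) 1 1)) ,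
    ≤-trans (+-monoʳ-≤ (gadgetStart (decode S) i) (s≤s z≤n)) (m≤m+n _ 1)
  decode-potential-feasible S st∉S (i , eNext) st∈S ends≡ with view i
  ... | ‵fromℕ = contradiction (trans (sym st∈S) st∉S) λ ()
  ... | ‵inject₁ j with trans (sym ends≡) (ends-inner j)
  ...   | refl rewrite ∑<-inject₁ (λ i → gadgetLength (decode S) i + 1) j =
    ≤-reflexive (sym (+-assoc (gadgetStart (decode S) (inject₁ j)) _ 1)) ,
    ≤-trans (+-monoʳ-≤ (gadgetStart (decode S) (inject₁ j)) (m≤m+n _ 1)) (m≤m+n _ 1)

  decode-pathLength-≤ : ∀ {S ℓ} → S (last , eNext) ≡ false → Walk G S s t ℓ →
                        pathLength (decode S) ≤ ℓ
  decode-pathLength-≤ {S} st∉S = potential-≤ (decode-potential-feasible S st∉S)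

lemma6 : (n : ℕ) → 2 ≤ n → (c¹ c² : Fin n → ℕ) →
         (∀ i → 1 ≤ c¹ i) → (∀ i → 1 ≤ c² i) →
         (x : Fin n → Bool) → BUCOParetoOptimal c¹ c² x →
         MSpParetoOptimal (redGraph n c¹ c²) (Sx x)
lemma6 (suc (suc k)) _ c¹ c² _ _ x pareto = Sx-spanner x , undominated
  where
  open Reduction k c¹ c²
  open Walks.PositiveWeights G c₂-pos
  open Distances _≟ᵛ_ edges-complete
  undominated : ∀ S′ → Spanner G S′ → ∀ r r′ → IsStretch G (Sx x) r → IsStretch G S′ r′ →
                ¬ DominatedQ G (f₁ G (Sx x) , r) (f₁ G S′ , r′)
  undominated S′ S′-spanner r r′ r-stretch r′-stretch (≢ , f₁′≤f₁ , r′≤r) with S′ (last , eNext) in st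
  ... | true = <⇒≱ (st-cost S′ st) (≤-trans f₁′≤f₁ (Sx-cost-≤ x))
  ... | false =
    ≢ (cong₂ _,_ (≤-antisym (dot-≡⇒cost-≥ x S′ (proj₁ same-value)) f₁′≤f₁) (ℚₚ.≤-antisym r≤r′ r′≤r))
    where
    y : Fin (suc (suc k)) → Bool
    y = decode S′
    dist : ∃[ d ] IsDist G S′ s t d
    dist = distance S′ t (proj₂ (S′-spanner s t))
    y≤d : pathLength y ≤ proj₁ dist
    y≤d = decode-pathLength-≤ st (proj₁ (proj₂ dist))
    d≤r′ : ℤ.+ proj₁ dist ℚ./ 1 ℚ.≤ r′
    d≤r′ = stretch-≥ r′-stretch s≢t refl (inj₁ ends-last) (proj₂ dist)
    r≤x : r ℚ.≤ ℤ.+ pathLength x ℚ./ 1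
    r≤x = Sx-stretch-≤ x r-stretch
    y≤x : pathLength y ≤ pathLength x
    y≤x = ≤-trans y≤d (integer-≤⁻ (ℚₚ.≤-trans d≤r′ (ℚₚ.≤-trans r′≤r r≤x)))
    same-value : dot c¹ x ≡ dot c¹ y × dot c² x ≡ dot c² y
    same-value = pareto-optimal-≡ {x = x} pareto y (cost-≤⇒dot-≤ x S′ f₁′≤f₁) (pathLength-≤⇒dot-≤ y x y≤x)
    x≤d : pathLength x ≤ proj₁ dist
    x≤d = ≤-trans (≤-reflexive (dot-≡⇒pathLength-≡ x y (proj₂ same-value))) y≤d
    r≤r′ : r ℚ.≤ r′
    r≤r′ = ℚₚ.≤-trans r≤x (ℚₚ.≤-trans (integer-≤⁺ x≤d) d≤r′)
lemma6 zero () c¹ c² _ _ x pareto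
lemma6 (suc zero) (s≤s ()) c¹ c² _ _ x pareto
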